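{- Let $M$ be an $m \times n$ matrix over $\{ -1,0,1\}$. If the directed split graph $G_o(M)$ is semi-transitive, then every row of $M$ is of the form $0^r1^s0^t$ or $0^r(-1)^s0^t$ or $1^r0^s(-1)^t$ for some $r,s,t\ge 0$.
   Context: Rows of matrices are written as strings of length $n$; $x^r$ denotes the symbol $x$ repeated $r$ times. For an $m\times n$ matrix $M=[m_{ij}]$ over $\{ -1,0,1\}$, $G_o(M)$ is the directed graph on vertex set $\{1,\dots,n+m\}$ with edges $j\to i$ for all $1\le j<i\le n$, and for $1\le p\le m$, $1\le j\le n$: an edge $j\to n+p$ if $m_{pj}=1$, an edge $n+p\to j$ if $m_{pj}=-1$, no edge if $m_{pj}=0$; no edges among $n+1,\dots,n+m$. A directed graph is semi-transitive if it is acyclic and for every directed path $u_1\to\cdots\to u_t$, $t\ge2$, either there is no edge $u_1\to u_t$ or all edges $u_i\to u_j$ ($1\le i<j\le t$) exist. -}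

module Defs where

open import Data.Nat using (ℕ; zero; suc; _+_; _<_; _≤_)
open import Data.Fin using (Fin; toℕ; zero; suc)
open import Data.Fin.Base using () renaming (_<_ to _<ᶠ_)
open import Data.Sum using (_⊎_; inj₁; inj₂)
open import Data.Product using (_×_; ∃-syntax)
open import Data.Vec using (Vec; lookup)
open import Data.Empty using (⊥)
open import Relation.Binary.PropositionalEquality using (_≡_)
open import Relation.Nullary using (¬_)

data Entry : Set where
  -1' 0' 1' : Entry

Matrix : ℕ → ℕ → Set
Matrix m n = Fin m → Fin n → Entry

-- vertices of G_o(M): inj₁ j is column vertex j (i.e. j+1 ∈ {1..n}),
-- inj₂ p is row vertex n+p+1
Vertex : ℕ → ℕ → Set
Vertex m n = Fin n ⊎ Fin m

data Edge {m n : ℕ} (M : Matrix m n) : Vertex m n → Vertex m n → Set where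
  col→col : ∀ {i j : Fin n} → j <ᶠ i → Edge M (inj₁ j) (inj₁ i)
  col→row : ∀ {p : Fin m} {j : Fin n} → M p j ≡ 1' → Edge M (inj₁ j) (inj₂ p)
  row→col : ∀ {p : Fin m} {j : Fin n} → M p j ≡ -1' → Edge M (inj₂ p) (inj₁ j)

IsPath : ∀ {V : Set} (E : V → V → Set) {k : ℕ} → Vec V (suc k) → Set
IsPath E {k} us = (i : Fin k) → E (lookup us (Data.Fin.inject₁ i)) (lookup us (suc i))

Acyclic : ∀ {V : Set} (E : V → V → Set) → Set
Acyclic {V} E = ∀ (k : ℕ) (us : Vec V (suc (suc k))) → IsPath E us →
  ¬ (lookup us zero ≡ lookup us (Data.Fin.fromℕ (suc k)))

SemiTransitive : ∀ {V : Set} (E : V → V → Set) → Set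
SemiTransitive {V} E = Acyclic E ×
  (∀ (k : ℕ) (us : Vec V (suc (suc k))) → IsPath E us →
     E (lookup us zero) (lookup us (Data.Fin.fromℕ (suc k))) →
     ∀ (i j : Fin (suc (suc k))) → i <ᶠ j → E (lookup us i) (lookup us j))

-- a row (Fin n → Entry) equals x^r y^s z^t with r+s+t = n
Shape : ∀ {n : ℕ} → (Fin n → Entry) → Entry → Entry → Entry → Set
Shape {n} row x y z = ∃[ r ] ∃[ s ] ∃[ t ] (r + s + t ≡ n ×
  (∀ (j : Fin n) →
    (toℕ j < r → row j ≡ x) ×
    (r ≤ toℕ j → toℕ j < r + s → row j ≡ y) ×
    (r + s ≤ toℕ j → row j ≡ z)))

AllowedRow : ∀ {n : ℕ} → (Fin n → Entry) → Set
AllowedRow row = Shape row 0' 1' 0' ⊎ Shape row 0' -1' 0' ⊎ Shape row 1' 0' -1'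

-- Each of the patterns (−1,1), (1,0,1), (−1,0,−1), (0,1,−1), (1,−1,0), occurring as a
-- subsequence of a row p, yields in G_o(M) either a 3-cycle through the row vertex n+p
-- or a 4-vertex path whose chord from first to last vertex forces an edge that the
-- pattern's middle entry forbids.  A word over {−1,0,1} avoiding these five patterns
-- is one of 0^r1^s0^t, 0^r(−1)^s0^t, 1^r0^s(−1)^t: prepend the first letter to the
-- shape of the remaining word, each clash being an occurrence of a forbidden pattern.
module Submission where

open import Defs
open import Data.Nat using (ℕ; zero; suc; _+_; z≤n; s≤s; z<s) renaming (_<_ to _<ℕ_; _≤_ to _≤ℕ_)
open import Data.Nat.Properties using (+-identityʳ; ≤-refl; ≤-trans; <-trans; <-≤-trans; m≤m+n; m<m+n; <⇒≱; ≮⇒≥; _<?_)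
open import Data.Fin using (Fin; zero; suc; toℕ; fromℕ<)
open import Data.Fin.Base using () renaming (_<_ to _<ᶠ_)
open import Data.Fin.Properties using (toℕ<n; toℕ-fromℕ<)
open import Data.Sum using (inj₁; inj₂)
open import Data.Product using (_×_; _,_; proj₁; proj₂; ∃-syntax)
open import Data.Vec using (_∷_; [])
open import Data.Vec.Functional using (tail)
open import Data.Empty using (⊥; ⊥-elim)
open import Relation.Nullary using (¬_; yes; no)
open import Relation.Binary.PropositionalEquality using (_≡_; _≢_; refl; sym; trans; cong; subst)

module Chords {V : Set} {E : V → V → Set} where

  path₃ : ∀ {a b c d} → E a b → E b c → E c d → IsPath E (a ∷ b ∷ c ∷ d ∷ [])
  path₃ ab bc cd zero = ab
  path₃ ab bc cd (suc zero) = bc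
  path₃ ab bc cd (suc (suc zero)) = cd

  acyclic⇒no-triangle : Acyclic E → ∀ {a b c} → E a b → E b c → E c a → ⊥
  acyclic⇒no-triangle acyclic ab bc ca = acyclic 2 (_ ∷ _ ∷ _ ∷ _ ∷ []) (path₃ ab bc ca) refl

  chord₀₂ : SemiTransitive E → ∀ {a b c d} → E a b → E b c → E c d → E a d → E a c
  chord₀₂ (_ , st) ab bc cd ad =
    st 2 (_ ∷ _ ∷ _ ∷ _ ∷ []) (path₃ ab bc cd) ad zero (suc (suc zero)) z<s

  chord₁₃ : SemiTransitive E → ∀ {a b c d} → E a b → E b c → E c d → E a d → E b d
  chord₁₃ (_ , st) ab bc cd ad =
    st 2 (_ ∷ _ ∷ _ ∷ _ ∷ []) (path₃ ab bc cd) ad (suc zero) (suc (suc (suc zero))) (s≤s z<s)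

Occurs : ∀ {n} → (Fin n → Entry) → Entry → Set
Occurs f u = ∃[ a ] f a ≡ u

Contains₂ : ∀ {n} → (Fin n → Entry) → Entry → Entry → Set
Contains₂ f u v = ∃[ a ] ∃[ b ] (a <ᶠ b × f a ≡ u × f b ≡ v)

Contains₃ : ∀ {n} → (Fin n → Entry) → Entry → Entry → Entry → Set
Contains₃ f u v w = ∃[ a ] ∃[ b ] ∃[ c ] (a <ᶠ b × b <ᶠ c × f a ≡ u × f b ≡ v × f c ≡ w)

module _ {n : ℕ} {f : Fin (suc n) → Entry} where

  tail-contains₂ : ∀ {u v} → Contains₂ (tail f) u v → Contains₂ f u v
  tail-contains₂ (a , b , a<b , fa , fb) = suc a , suc b , s≤s a<b , fa , fb

  tail-contains₃ : ∀ {u v w} → Contains₃ (tail f) u v w → Contains₃ f u v w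
  tail-contains₃ (a , b , c , a<b , b<c , fa , fb , fc) =
    suc a , suc b , suc c , s≤s a<b , s≤s b<c , fa , fb , fc

  head-contains₂ : ∀ {u v} → f zero ≡ u → Occurs (tail f) v → Contains₂ f u v
  head-contains₂ f0 (b , fb) = zero , suc b , s≤s z≤n , f0 , fb

  head-contains₃ : ∀ {u v w} → f zero ≡ u → Contains₂ (tail f) v w → Contains₃ f u v w
  head-contains₃ f0 (b , c , b<c , fb , fc) = zero , suc b , suc c , z<s , s≤s b<c , f0 , fb , fc

record AvoidsForbiddenPatterns {n : ℕ} (f : Fin n → Entry) : Set where
  field
    no-−1,1 : ¬ Contains₂ f -1' 1'
    no-1,0,1 : ¬ Contains₃ f 1' 0' 1'
    no-−1,0,−1 : ¬ Contains₃ f -1' 0' -1'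
    no-0,1,−1 : ¬ Contains₃ f 0' 1' -1'
    no-1,−1,0 : ¬ Contains₃ f 1' -1' 0'
open AvoidsForbiddenPatterns

avoids-tail : ∀ {n} {f : Fin (suc n) → Entry} → AvoidsForbiddenPatterns f → AvoidsForbiddenPatterns (tail f)
avoids-tail av .no-−1,1 c = no-−1,1 av (tail-contains₂ c)
avoids-tail av .no-1,0,1 c = no-1,0,1 av (tail-contains₃ c)
avoids-tail av .no-−1,0,−1 c = no-−1,0,−1 av (tail-contains₃ c)
avoids-tail av .no-0,1,−1 c = no-0,1,−1 av (tail-contains₃ c)
avoids-tail av .no-1,−1,0 c = no-1,−1,0 av (tail-contains₃ c)

0'≢1' : 0' ≢ 1'
0'≢1' ()

0'≢-1' : 0' ≢ -1'
0'≢-1' ()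

module _ {m n : ℕ} {M : Matrix m n} where
  open Chords {E = Edge M}

  col→row⁻¹ : ∀ {p j} → Edge M (inj₁ j) (inj₂ p) → M p j ≡ 1'
  col→row⁻¹ (col→row e) = e

  row→col⁻¹ : ∀ {p j} → Edge M (inj₂ p) (inj₁ j) → M p j ≡ -1'
  row→col⁻¹ (row→col e) = e

  semiTransitive⇒avoids : SemiTransitive (Edge M) → (p : Fin m) → AvoidsForbiddenPatterns (M p)
  semiTransitive⇒avoids st p .no-−1,1 (a , b , a<b , ea , eb) =
    acyclic⇒no-triangle (proj₁ st) (row→col ea) (col→col a<b) (col→row eb)
  semiTransitive⇒avoids st p .no-1,0,1 (a , b , c , a<b , b<c , ea , eb , ec) =
    0'≢1' (trans (sym eb) (col→row⁻¹
      (chord₁₃ st (col→col a<b) (col→col b<c) (col→row ec) (col→row ea))))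
  semiTransitive⇒avoids st p .no-−1,0,−1 (a , b , c , a<b , b<c , ea , eb , ec) =
    0'≢-1' (trans (sym eb) (row→col⁻¹
      (chord₀₂ st (row→col ea) (col→col a<b) (col→col b<c) (row→col ec))))
  semiTransitive⇒avoids st p .no-0,1,−1 (a , b , c , a<b , b<c , ea , eb , ec) =
    0'≢1' (trans (sym ea) (col→row⁻¹
      (chord₀₂ st (col→col a<b) (col→row eb) (row→col ec) (col→col (<-trans a<b b<c)))))
  semiTransitive⇒avoids st p .no-1,−1,0 (a , b , c , a<b , b<c , ea , eb , ec) =
    0'≢-1' (trans (sym ec) (row→col⁻¹
      (chord₁₃ st (col→row ea) (row→col eb) (col→col b<c) (col→col (<-trans a<b b<c)))))

Blocks : ∀ {n} → (Fin n → Entry) → Entry → Entry → Entry → ℕ → ℕ → ℕ → Set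
Blocks {n} row x y z r s t = r + s + t ≡ n × (∀ (j : Fin n) →
    (toℕ j <ℕ r → row j ≡ x) ×
    (r ≤ℕ toℕ j → toℕ j <ℕ r + s → row j ≡ y) ×
    (r + s ≤ℕ toℕ j → row j ≡ z))

module _ {n : ℕ} {f : Fin (suc n) → Entry} {x y z : Entry} where

  cons-first : ∀ {r s t} → f zero ≡ x → Blocks (tail f) x y z r s t → Blocks f x y z (suc r) s t
  cons-first f0 (eq , b) = cong suc eq , λ
    { zero → (λ _ → f0) , (λ ()) , (λ ())
    ; (suc j) → (λ { (s≤s j<r) → proj₁ (b j) j<r })
              , (λ { (s≤s r≤j) (s≤s j<r+s) → proj₁ (proj₂ (b j)) r≤j j<r+s })
              , (λ { (s≤s r+s≤j) → proj₂ (proj₂ (b j)) r+s≤j }) }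

  cons-middle : ∀ {s t} → f zero ≡ y → Blocks (tail f) x y z 0 s t → Blocks f x y z 0 (suc s) t
  cons-middle f0 (eq , b) = cong suc eq , λ
    { zero → (λ ()) , (λ _ _ → f0) , (λ ())
    ; (suc j) → (λ ())
              , (λ { _ (s≤s j<s) → proj₁ (proj₂ (b j)) z≤n j<s })
              , (λ { (s≤s s≤j) → proj₂ (proj₂ (b j)) s≤j }) }

toℕ<-≡ : ∀ {n k} (j : Fin n) → k ≡ n → toℕ j <ℕ k
toℕ<-≡ j refl = toℕ<n j

module _ {n : ℕ} {g : Fin n → Entry} {x y z : Entry} where

  shiftˡ : ∀ {s t w} → Blocks g x y z 0 s t → Blocks g y z w s t 0
  shiftˡ {s} {t} (eq , b) = eq′ , λ j →
      (λ j<s → proj₁ (proj₂ (b j)) z≤n j<s)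
    , (λ s≤j _ → proj₂ (proj₂ (b j)) s≤j)
    , (λ s+t≤j → ⊥-elim (<⇒≱ (toℕ<-≡ j eq) s+t≤j))
    where
    eq′ : s + t + 0 ≡ n
    eq′ = trans (+-identityʳ (s + t)) eq

  shiftʳ : ∀ {r s w} → Blocks g x y z r s 0 → Blocks g w x y 0 r s
  shiftʳ {r} {s} (eq , b) = eq′ , λ j →
      (λ ())
    , (λ _ j<r → proj₁ (b j) j<r)
    , (λ r≤j → proj₁ (proj₂ (b j)) r≤j (toℕ<-≡ j eq′))
    where
    eq′ : r + s ≡ n
    eq′ = trans (sym (+-identityʳ (r + s))) eq

constant-blocks : ∀ {n} {g : Fin n → Entry} {x y y′ r t} → Blocks g x y x r 0 t → Blocks g x y′ x 0 0 n
constant-blocks {g = g} {x} {r = r} (_ , b) = refl , λ j → (λ ()) , (λ _ ()) , (λ _ → g≡x j)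
  where
  g≡x : ∀ j → g j ≡ x
  g≡x j with toℕ j <? r
  ... | yes j<r = proj₁ (b j) j<r
  ... | no j≮r = proj₂ (proj₂ (b j)) (subst (_≤ℕ toℕ j) (sym (+-identityʳ r)) (≮⇒≥ j≮r))

module _ {n : ℕ} {g : Fin n → Entry} {x y z : Entry} {r s t : ℕ} (b : Blocks g x y z r s t) where

  private
    entry-at : ∀ {k u} → k <ℕ r + s + t → (∀ j → toℕ j ≡ k → g j ≡ u) → ∃[ j ] (toℕ j ≡ k × g j ≡ u)
    entry-at {k} k<r+s+t val = fromℕ< k<n , toℕ-fromℕ< k<n , val _ (toℕ-fromℕ< k<n)
      where
      k<n : k <ℕ n
      k<n = subst (k <ℕ_) (proj₁ b) k<r+s+t

    ordered : ∀ {k l u v} → ∃[ i ] (toℕ i ≡ k × g i ≡ u) → ∃[ j ] (toℕ j ≡ l × g j ≡ v) →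
      k <ℕ l → Contains₂ g u v
    ordered (i , refl , gi) (j , refl , gj) i<j = i , j , i<j , gi , gj

  x-at : ∀ {k} → k <ℕ r → ∃[ j ] (toℕ j ≡ k × g j ≡ x)
  x-at k<r = entry-at (<-≤-trans k<r (≤-trans (m≤m+n r s) (m≤m+n (r + s) t)))
    (λ j tj → proj₁ (proj₂ b j) (subst (_<ℕ r) (sym tj) k<r))

  y-at : ∀ {k} → r ≤ℕ k → k <ℕ r + s → ∃[ j ] (toℕ j ≡ k × g j ≡ y)
  y-at r≤k k<r+s = entry-at (<-≤-trans k<r+s (m≤m+n (r + s) t))
    (λ j tj → proj₁ (proj₂ (proj₂ b j)) (subst (r ≤ℕ_) (sym tj) r≤k) (subst (_<ℕ r + s) (sym tj) k<r+s))

  z-at : ∀ {k} → r + s ≤ℕ k → k <ℕ r + s + t → ∃[ j ] (toℕ j ≡ k × g j ≡ z)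
  z-at r+s≤k k<n = entry-at k<n (λ j tj → proj₂ (proj₂ (proj₂ b j)) (subst (r + s ≤ℕ_) (sym tj) r+s≤k))

  x-occurs : 0 <ℕ r → Occurs g x
  x-occurs 0<r with x-at 0<r
  ... | j , _ , gj = j , gj

  y-occurs : 0 <ℕ s → Occurs g y
  y-occurs 0<s with y-at ≤-refl (m<m+n r 0<s)
  ... | j , _ , gj = j , gj

  x-before-y : 0 <ℕ r → 0 <ℕ s → Contains₂ g x y
  x-before-y 0<r 0<s = ordered (x-at 0<r) (y-at ≤-refl (m<m+n r 0<s)) 0<r

  y-before-z : 0 <ℕ s → 0 <ℕ t → Contains₂ g y z
  y-before-z 0<s 0<t =
    ordered (y-at ≤-refl (m<m+n r 0<s)) (z-at ≤-refl (m<m+n (r + s) 0<t)) (m<m+n r 0<s)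

  x-before-z : 0 <ℕ r → 0 <ℕ t → Contains₂ g x z
  x-before-z 0<r 0<t =
    ordered (x-at 0<r) (z-at ≤-refl (m<m+n (r + s) 0<t)) (<-≤-trans 0<r (m≤m+n r s))

module _ {n : ℕ} {f : Fin (suc n) → Entry} (av : AvoidsForbiddenPatterns f) where

  cons-0*1*0* : ∀ v → f zero ≡ v → ∀ {r s t} → Blocks (tail f) 0' 1' 0' r s t → AllowedRow f
  cons-0*1*0* 0' f0 b = inj₁ (_ , _ , _ , cons-first f0 b)
  cons-0*1*0* 1' f0 {zero} b = inj₁ (_ , _ , _ , cons-middle f0 b)
  cons-0*1*0* 1' f0 {suc _} {zero} b = inj₁ (_ , _ , _ , cons-middle f0 (constant-blocks b))
  cons-0*1*0* 1' f0 {suc _} {suc _} b =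
    ⊥-elim (no-1,0,1 av (head-contains₃ f0 (x-before-y b z<s z<s)))
  cons-0*1*0* -1' f0 {s = zero} b = inj₂ (inj₁ (_ , _ , _ , cons-middle f0 (constant-blocks b)))
  cons-0*1*0* -1' f0 {s = suc _} b = ⊥-elim (no-−1,1 av (head-contains₂ f0 (y-occurs b z<s)))

  cons-0*−1*0* : ∀ v → f zero ≡ v → ∀ {r s t} → Blocks (tail f) 0' -1' 0' r s t → AllowedRow f
  cons-0*−1*0* 0' f0 b = inj₂ (inj₁ (_ , _ , _ , cons-first f0 b))
  cons-0*−1*0* -1' f0 {zero} b = inj₂ (inj₁ (_ , _ , _ , cons-middle f0 b))
  cons-0*−1*0* -1' f0 {suc _} {zero} b = inj₂ (inj₁ (_ , _ , _ , cons-middle f0 (constant-blocks b)))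
  cons-0*−1*0* -1' f0 {suc _} {suc _} b =
    ⊥-elim (no-−1,0,−1 av (head-contains₃ f0 (x-before-y b z<s z<s)))
  cons-0*−1*0* 1' f0 {s = zero} b = inj₁ (_ , _ , _ , cons-middle f0 (constant-blocks b))
  cons-0*−1*0* 1' f0 {s = suc _} {zero} b = inj₂ (inj₂ (_ , _ , _ , cons-first f0 (shiftʳ b)))
  cons-0*−1*0* 1' f0 {s = suc _} {suc _} b =
    ⊥-elim (no-1,−1,0 av (head-contains₃ f0 (y-before-z b z<s z<s)))

  cons-1*0*−1* : ∀ v → f zero ≡ v → ∀ {r s t} → Blocks (tail f) 1' 0' -1' r s t → AllowedRow f
  cons-1*0*−1* 1' f0 b = inj₂ (inj₂ (_ , _ , _ , cons-first f0 b))
  cons-1*0*−1* 0' f0 {zero} b = inj₂ (inj₁ (_ , _ , _ , cons-first f0 (shiftˡ b)))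
  cons-1*0*−1* 0' f0 {suc _} {t = zero} b = inj₁ (_ , _ , _ , cons-first f0 (shiftʳ b))
  cons-1*0*−1* 0' f0 {suc _} {t = suc _} b =
    ⊥-elim (no-0,1,−1 av (head-contains₃ f0 (x-before-z b z<s z<s)))
  cons-1*0*−1* -1' f0 {zero} b = cons-0*−1*0* -1' f0 (shiftˡ b)
  cons-1*0*−1* -1' f0 {suc _} b = ⊥-elim (no-−1,1 av (head-contains₂ f0 (x-occurs b z<s)))

avoids⇒allowed : ∀ {n} (f : Fin n → Entry) → AvoidsForbiddenPatterns f → AllowedRow f
avoids⇒allowed {zero} f av = inj₁ (0 , 0 , 0 , refl , λ ())
avoids⇒allowed {suc n} f av with avoids⇒allowed (tail f) (avoids-tail av)
... | inj₁ (_ , _ , _ , b) = cons-0*1*0* av (f zero) refl b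
... | inj₂ (inj₁ (_ , _ , _ , b)) = cons-0*−1*0* av (f zero) refl b
... | inj₂ (inj₂ (_ , _ , _ , b)) = cons-1*0*−1* av (f zero) refl b

corollary2p14 : (m n : ℕ) (M : Matrix m n) → SemiTransitive (Edge M) →
    (p : Fin m) → AllowedRow (M p)
corollary2p14 m n M st p = avoids⇒allowed (M p) (semiTransitive⇒avoids st p)
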